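{- Let $S$ be a set of clauses each of which has at most two literals. Then in any derivation from $S$, every clause added by the Learn rule has fewer than two literals.
   Context: First-order logic without equality; literals are atoms or negated atoms; $\bar L$ is the complement of $L$; clauses are finite multisets of literals read as disjunctions; $\bot$ is the empty clause; $L\vee\Gamma$ denotes $\{L\}\cup\Gamma$; $g(S)$, $ng(S)$ are the ground and non-ground clauses of $S$; $Vars(C)$ is the set of variables of $C$. A trigger function maps $C\in ng(S)$ to $Trig(C)\subseteq C$ with $Vars(Trig(C))=Vars(C)$. $I$-Instantiation (for a set $I$ of ground literals): from $C=L_1\vee\dots\vee L_n\vee\Gamma\in ng(S)$ with $Trig(C)=\{L_1,\dots,L_n\}$ and $\theta$ with $\bar{L_i}\theta\in I$ for all $i$, infer $C\theta$. For a set $I$ of literals, $I\models\neg\Gamma$ means $\bar K\in I$ for every $K\in\Gamma$. CDCL-with-instantiation calculus: states are $\langle G,M,LC\rangle$ with $G$ a set of ground clauses, $M$ a list of ground literals (most recent first, also viewed as a set), $LC$ either $\emptyset$ or $\{C\}$. For $M=[L_n,\dots,L_1]$, $M[L_i\cdots]=[L_i,\dots,L_1]$. $Count_M(L)=|M[L\cdots]|$ if $L\in M$, else $\omega$; $L\le_M L'$ iff $Count_M(L)\le Count_M(L')$; $Sort_M(C)$ lists $C$ in descending $\le_M$-order, $Sort_M(G)=\{Sort_M(C):C\in G\}$; $Level_M(L)$ is the number of literals of $M[L\cdots]$ added by Decide if $L\in M$, else $\omega$. Rules: Decide: $\langle G,M,\emptyset\rangle\Rightarrow\langle G,\neg A:M,\emptyset\rangle$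 if there is no clause $L\vee\Gamma$ in $Sort_M(G)$ with $M\models\neg\Gamma$, and $A,\neg A\notin M$. Propagate: $\langle G,M,\emptyset\rangle\Rightarrow\langle G,L:M,\emptyset\rangle$ if some $L\vee\Gamma$ in $Sort_M(G)$ has $M\models\neg\Gamma$ and $L,\bar L\notin M$ (this clause produces $L$). Conflict: $\langle G,M,\emptyset\rangle\Rightarrow\langle G,M,\{C\}\rangle$ if $C\in G$ and $M\models\neg C$. Backjump: $\langle G,M,\{C\}\rangle\Rightarrow\langle G,M,\{\Delta\vee\Gamma\}\rangle$ if $Sort_M(C)=\bar L\vee\Gamma$, some $L'\in\Gamma$ has $Level(L')=Level(L)$, and $L\vee\Delta$ is the clause that produced $L$. Learn: $\langle G,M,\{C\}\rangle\Rightarrow\langle G\cup\{C\},M',\emptyset\rangle$ if Backjump does not apply, $C\neq\bot$, with $M'=[]$ if $C$ is a unit clause and $M'=M[\bar L\cdots]$ if $Sort_M(C)=L'\vee L\vee\Gamma$. Instantiate: $\langle G,M,\emptyset\rangle\Rightarrow\langle G\cup\{C\},M',\emptyset\rangle$ if $C$ is the conclusion of an $M$-Instantiation inference and $C\notin G$, with $M'=[]$ if $C$ is unit, and for $Sort_M(C)=L'\vee L\vee\Gamma$: $M'=M[\bar L\cdots]$ if $M\models\neg(L\vee\Gamma)$, $M'=M$ otherwise. Succeed: $\langle G,M,\emptyset\rangle\Rightarrow(SAT,M)$ if no $C\in G$ has $M\models\neg C$, all atoms of $G$ are defined by $M$, and Instantiate does not apply. Fail: $\langle G,M,\{\bot\}\rangle\Rightarrow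 UNSAT$. A derivation from $S$ is a sequence of steps starting from $\langle g(S),[],\emptyset\rangle$.
   Formalization: A clause added by Learn has fewer than two distinct literals, and $Count_M(L)$ and $Level_M(L)$ are taken at the entry of M containing L or $\bar L$, not only when L ∈ M. The statement above fails without it. -}

module Defs where

open import Data.Nat using (ℕ; zero; suc; _≤_)
open import Data.Bool using (Bool; true; false; not)
open import Data.Maybe using (Maybe; just; nothing)
open import Data.List using (List; []; _∷_; _++_; length; map)
open import Data.List.Membership.Propositional using (_∈_; _∉_)
open import Data.List.Relation.Unary.Any using (Any)
open import Data.List.Relation.Unary.Linked using (Linked)
open import Data.List.Relation.Binary.Permutation.Propositional using (_↭_)
open import Data.Vec using (Vec; []; _∷_)
import Data.Vec.Relation.Unary.Any as VAny
open import Data.Product using (Σ; ∃; _×_; _,_)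
open import Data.Sum using (_⊎_)
open import Data.Empty using (⊥)
open import Relation.Nullary using (¬_)
open import Relation.Binary.PropositionalEquality using (_≡_; _≢_)

record Signature : Set₁ where
  field
    Fun       : Set
    funArity  : Fun → ℕ
    Pred      : Set
    predArity : Pred → ℕ

data ℕω : Set where
  fin : ℕ → ℕω
  ω   : ℕω

data _≤ω_ : ℕω → ℕω → Set where
  fin≤fin : ∀ {m n} → m ≤ n → fin m ≤ω fin n
  _≤ω-ω   : ∀ u → u ≤ω ω

module FOL (sig : Signature) where
  open Signature sig

  data Term : Set where
    var : ℕ → Term
    fun : (f : Fun) → Vec Term (funArity f) → Term

  Subst : Set
  Subst = ℕ → Term

  mutual
    substT : Subst → Term → Term
    substT θ (var x)    = θ x
    substT θ (fun f ts) = fun f (substTs θ ts)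

    substTs : ∀ {n} → Subst → Vec Term n → Vec Term n
    substTs θ []       = []
    substTs θ (t ∷ ts) = substT θ t ∷ substTs θ ts

  data _occursIn_ (x : ℕ) : Term → Set where
    occ-var : x occursIn var x
    occ-fun : ∀ {f ts} → VAny.Any (x occursIn_) ts → x occursIn fun f ts

  record Atom : Set where
    constructor atm
    field
      pred : Pred
      args : Vec Term (predArity pred)
  open Atom public

  substA : Subst → Atom → Atom
  substA θ (atm p ts) = atm p (substTs θ ts)

  _occursInA_ : ℕ → Atom → Set
  x occursInA a = VAny.Any (x occursIn_) (args a)

  -- literals: polarity (true = positive) and atom
  record Literal : Set where
    constructor lit
    field
      pol  : Bool
      atom : Atom
  open Literal public

  ¬ₗ : Atom → Literal
  ¬ₗ A = lit false A

  comp : Literal → Literal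
  comp (lit b A) = lit (not b) A

  substL : Subst → Literal → Literal
  substL θ (lit b A) = lit b (substA θ A)

  -- clauses: finite multisets of literals, represented as lists
  -- (identified up to permutation _↭_)
  Clause : Set
  Clause = List Literal

  substC : Subst → Clause → Clause
  substC θ C = map (substL θ) C

  _∈Vars_ : ℕ → Clause → Set
  x ∈Vars C = Any (λ L → x occursInA atom L) C

  GroundAtom : Atom → Set
  GroundAtom A = ∀ x → ¬ (x occursInA A)

  GroundClause : Clause → Set
  GroundClause C = ∀ x → ¬ (x ∈Vars C)

  ClauseSet : Set₁
  ClauseSet = Clause → Set

  g : ClauseSet → ClauseSet
  g S C = S C × GroundClause C

  ng : ClauseSet → ClauseSet
  ng S C = S C × ¬ GroundClause C

  _∈G_ : Clause → ClauseSet → Set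
  C ∈G G = ∃ λ D → G D × (D ↭ C)

  _∪[_] : ClauseSet → Clause → ClauseSet
  (G ∪[ C ]) D = G D ⊎ D ≡ C

  record TriggerFunction (S : ClauseSet) : Set where
    field
      Trig      : Clause → Clause
      trig-sub  : ∀ C → ng S C → ∃ λ Γ → (Trig C ++ Γ) ↭ C
      trig-vars : ∀ C → ng S C → ∀ x →
                  (x ∈Vars Trig C → x ∈Vars C) × (x ∈Vars C → x ∈Vars Trig C)
  open TriggerFunction public

  -- Trails. Each entry records the literal and how it was added:
  -- reason = nothing  : added by Decide
  -- reason = just D   : added by Propagate, D = L ∨ Γ the producing clause
  record Entry : Set where
    constructor entry
    field
      elit   : Literal
      reason : Maybe Clause
  open Entry public

  Trail : Set
  Trail = List Entry   -- most recent first

  _∈M_ : Literal → Trail → Set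
  L ∈M M = L ∈ map elit M

  _∉M_ : Literal → Trail → Set
  L ∉M M = ¬ (L ∈M M)

  _⊨¬_ : Trail → Clause → Set
  M ⊨¬ Γ = ∀ K → K ∈ Γ → comp K ∈M M

  -- M[L⋯] : suffix of M starting at (the most recent occurrence of) L
  data Suffix : Trail → Literal → Trail → Set where
    here  : ∀ {e M L} → elit e ≡ L → Suffix (e ∷ M) L (e ∷ M)
    there : ∀ {e M L S} → elit e ≢ L → Suffix M L S → Suffix (e ∷ M) L S

  data AtSuffix : Trail → Literal → Trail → Set where
    here  : ∀ {e M L} → atom (elit e) ≡ atom L → AtSuffix (e ∷ M) L (e ∷ M)
    there : ∀ {e M L S} → atom (elit e) ≢ atom L → AtSuffix M L S → AtSuffix (e ∷ M) L S

  decisions : Trail → ℕ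
  decisions [] = zero
  decisions (entry _ nothing  ∷ M) = suc (decisions M)
  decisions (entry _ (just _) ∷ M) = decisions M

  data CountIs (M : Trail) (L : Literal) : ℕω → Set where
    cnt-fin : ∀ {S} → AtSuffix M L S → CountIs M L (fin (length S))
    cnt-ω   : (∀ S → ¬ AtSuffix M L S) → CountIs M L ω

  data LevelIs (M : Trail) (L : Literal) : ℕω → Set where
    lvl-fin : ∀ {S} → AtSuffix M L S → LevelIs M L (fin (decisions S))
    lvl-ω   : (∀ S → ¬ AtSuffix M L S) → LevelIs M L ω

  _≤[_]_ : Literal → Trail → Literal → Set
  L ≤[ M ] L' = ∀ u v → CountIs M L u → CountIs M L' v → u ≤ω v

  IsSortOf : Trail → Clause → Clause → Set
  IsSortOf M C xs = (xs ↭ C) × Linked (λ a b → b ≤[ M ] a) xs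

  InSort : ClauseSet → Trail → Literal → Clause → Set
  InSort G M L Γ = ∃ λ C → G C × IsSortOf M C (L ∷ Γ)

  data State : Set₁ where
    ⟨_,_,_⟩ : ClauseSet → Trail → Maybe Clause → State   -- LC = ∅ / {C}
    SAT     : Trail → State
    UNSAT   : State

  initial : ClauseSet → State
  initial S = ⟨ g S , [] , nothing ⟩

  -- I-Instantiation with I = M: C' is a conclusion
  MInstantiation : (S : ClauseSet) → TriggerFunction S → Trail → Clause → Set
  MInstantiation S T M C' =
    ∃ λ C → ng S C × ∃ λ (θ : Subst) →
      (∀ L → L ∈ Trig T C → substL θ (comp L) ∈M M) × (C' ≡ substC θ C)

  data InstTrail (M : Trail) (C : Clause) : Trail → Set where
    unit  : length C ≡ 1 → InstTrail M C []
    back  : ∀ {L' L Γ S} → IsSortOf M C (L' ∷ L ∷ Γ) → M ⊨¬ (L ∷ Γ) →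
            Suffix M (comp L) S → InstTrail M C S
    stay  : ∀ {L' L Γ} → IsSortOf M C (L' ∷ L ∷ Γ) → ¬ (M ⊨¬ (L ∷ Γ)) →
            InstTrail M C M

  data Instantiate (S : ClauseSet) (T : TriggerFunction S) : State → State → Set₁ where
    instantiate : ∀ {G M C M'} → MInstantiation S T M C → ¬ (C ∈G G) →
                  InstTrail M C M' →
                  Instantiate S T ⟨ G , M , nothing ⟩ ⟨ G ∪[ C ] , M' , nothing ⟩

  data Backjump : State → State → Set₁ where
    backjump : ∀ {G M C K Γ L' Δ e S} →
               IsSortOf M C (K ∷ Γ) →                 -- Sort_M(C) = L̄ ∨ Γ, L = comp K
               L' ∈ Γ →
               (∃ λ v → LevelIs M L' v × LevelIs M (comp K) v) →
               Suffix M (comp K) (e ∷ S) →             -- the entry for L ...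
               reason e ≡ just (comp K ∷ Δ) →          -- ... was produced by L ∨ Δ
               Backjump ⟨ G , M , just C ⟩ ⟨ G , M , just (Δ ++ Γ) ⟩

  data LearnTrail (M : Trail) (C : Clause) : Trail → Set where
    unit    : length C ≡ 1 → LearnTrail M C []
    nonunit : ∀ {L' L Γ S} → IsSortOf M C (L' ∷ L ∷ Γ) →
              Suffix M (comp L) S → LearnTrail M C S

  data Learn : State → State → Set₁ where
    learn : ∀ {G M C M'} →
            ¬ (Σ State λ s → Backjump ⟨ G , M , just C ⟩ s) →
            C ≢ [] →
            LearnTrail M C M' →
            Learn ⟨ G , M , just C ⟩ ⟨ G ∪[ C ] , M' , nothing ⟩

  data Step (S : ClauseSet) (T : TriggerFunction S) : State → State → Set₁ where
    decide    : ∀ {G M A} →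
                ¬ (∃ λ L → ∃ λ Γ → InSort G M L Γ × M ⊨¬ Γ) →
                GroundAtom A →
                lit true A ∉M M → ¬ₗ A ∉M M →
                Step S T ⟨ G , M , nothing ⟩ ⟨ G , entry (¬ₗ A) nothing ∷ M , nothing ⟩
    propagate : ∀ {G M L Γ} →
                InSort G M L Γ → M ⊨¬ Γ → L ∉M M → comp L ∉M M →
                Step S T ⟨ G , M , nothing ⟩ ⟨ G , entry L (just (L ∷ Γ)) ∷ M , nothing ⟩
    conflict  : ∀ {G M C} → G C → M ⊨¬ C →
                Step S T ⟨ G , M , nothing ⟩ ⟨ G , M , just C ⟩
    backjumpₛ : ∀ {s s'} → Backjump s s' → Step S T s s'
    learnₛ    : ∀ {s s'} → Learn s s' → Step S T s s'
    instₛ     : ∀ {s s'} → Instantiate S T s s' → Step S T s s'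
    succeed   : ∀ {G M} →
                ¬ (∃ λ C → G C × M ⊨¬ C) →
                (∀ C → G C → ∀ K → K ∈ C → K ∈M M ⊎ comp K ∈M M) →
                ¬ (Σ State λ s → Instantiate S T ⟨ G , M , nothing ⟩ s) →
                Step S T ⟨ G , M , nothing ⟩ (SAT M)
    fail      : ∀ {G M} → Step S T ⟨ G , M , just [] ⟩ UNSAT

  -- "C has fewer than two literals" (counted as distinct literals)
  FewerThanTwoLiterals : Clause → Set
  FewerThanTwoLiterals C = ∀ K K' → K ∈ C → K' ∈ C → K ≡ K'

-- Every reachable state satisfies an invariant: no atom is assigned twice on the trail, every
-- propagated literal L is justified by a clause L ∨ Δ of G with Δ falsified below it, the clauses
-- of G and the conflict clause have at most two literals, and none of them was unit (one literal
-- false, another unassigned) at the moment of any decision on the trail.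
--
-- Under this invariant a conflict clause {K, L} with K̄ above L̄ on the trail admits Backjump:
-- had K̄ been decided, or had a decision been taken between L̄ and K̄, the clause would have been
-- unit at that decision; so K̄ was propagated at the level of L̄. Hence Learn only receives
-- clauses with fewer than two literals, and these trivially keep the invariant. Backjump keeps it
-- because the resolvent {δ, L} of {K, L} with the reason {K̄, δ} can only be unit at a decision
-- where {K, L} or {K̄, δ} already was. Instantiate keeps it because, for the sorted instance
-- L′ ∨ L, the new trail has no L̄ below a decision, and L̄′ below a decision would force L, which
-- is assigned no later than L′, to be assigned there as well.

module Submission where

open import Defs
open import Data.Nat using (_≤_; _≤?_; s≤s; z≤n)
open import Data.Nat.Properties using (≤-refl; ≤-trans; m≤n⇒m≤1+n; 1+n≰n; ≰⇒>)
open import Data.Bool using (true; false)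
open import Data.Bool.Properties using (not-involutive)
open import Data.List using (List; []; _∷_; _++_; length)
open import Data.List.Properties using (length-map)
open import Data.List.Membership.Propositional using (_∈_)
open import Data.List.Relation.Unary.Any using (here; there)
open import Data.List.Relation.Unary.All using (All; []; _∷_)
open import Data.List.Relation.Unary.AllPairs using (AllPairs; []; _∷_)
open import Data.List.Relation.Unary.Linked using ([-]; _∷_)
open import Data.List.Relation.Binary.Permutation.Propositional using (_↭_; ↭-refl; ↭-sym; ↭-swap)
open import Data.List.Relation.Binary.Permutation.Propositional.Properties using (↭-length; ∈-resp-↭)
open import Data.Maybe using (just; nothing)
open import Data.Product using (Σ; ∃; ∃₂; _×_; _,_; proj₁)
open import Data.Sum using (_⊎_; inj₁; inj₂)
open import Data.Empty using (⊥; ⊥-elim)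
open import Data.Unit using (⊤; tt)
open import Function using (_∘_)
open import Relation.Nullary using (¬_; yes; no)
open import Relation.Binary.PropositionalEquality using (_≡_; _≢_; refl; sym; trans; cong; subst; subst₂)
open import Relation.Binary.Construct.Closure.ReflexiveTransitive using (Star; ε; _◅_)

-- xs ≼ ys : xs is a suffix of ys (the library's Suffix relation wraps equality in Pointwise).
infix 4 _≼_

data _≼_ {A : Set} : List A → List A → Set where
  ≼-refl : ∀ {xs} → xs ≼ xs
  ≼-step : ∀ {x xs ys} → xs ≼ ys → xs ≼ (x ∷ ys)

module _ {A : Set} where

  ≼-trans : {xs ys zs : List A} → xs ≼ ys → ys ≼ zs → xs ≼ zs
  ≼-trans p ≼-refl     = p
  ≼-trans p (≼-step q) = ≼-step (≼-trans p q)

  ≼-tail : {x : A} {xs ys : List A} → (x ∷ xs) ≼ ys → xs ≼ ys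
  ≼-tail = ≼-trans (≼-step ≼-refl)

  ≼-∷⁻ : {x y : A} {xs ys : List A} → (x ∷ xs) ≼ (y ∷ ys) → xs ≼ ys
  ≼-∷⁻ ≼-refl     = ≼-refl
  ≼-∷⁻ (≼-step p) = ≼-tail p

  []≼ : {xs : List A} → [] ≼ xs
  []≼ {[]}    = ≼-refl
  []≼ {_ ∷ _} = ≼-step []≼

  ≼-length : {xs ys : List A} → xs ≼ ys → length xs ≤ length ys
  ≼-length ≼-refl     = ≤-refl
  ≼-length (≼-step p) = m≤n⇒m≤1+n (≼-length p)

  ≼-by-length : {xs ys zs : List A} → xs ≼ zs → ys ≼ zs → length xs ≤ length ys → xs ≼ ys
  ≼-by-length ≼-refl     ≼-refl     _  = ≼-refl
  ≼-by-length ≼-refl     (≼-step q) le = ⊥-elim (1+n≰n (≤-trans le (≼-length q)))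
  ≼-by-length (≼-step p) ≼-refl     _  = ≼-step p
  ≼-by-length (≼-step p) (≼-step q) le = ≼-by-length p q le

  ≼-connex : {xs ys zs : List A} {y : A} → xs ≼ zs → (y ∷ ys) ≼ zs → xs ≼ ys ⊎ (y ∷ ys) ≼ xs
  ≼-connex {xs} {ys} p q with length xs ≤? length ys
  ... | yes xs≤ys = inj₁ (≼-by-length p (≼-tail q) xs≤ys)
  ... | no  xs≰ys = inj₂ (≼-by-length q p (≰⇒> xs≰ys))

ω≰fin : ∀ {n} → ¬ (ω ≤ω fin n)
ω≰fin ()

module BinaryCDCL (sig : Signature) where
  open FOL sig

  atom-comp : ∀ L → atom (comp L) ≡ atom L
  atom-comp (lit _ _) = refl

  comp-involutive : ∀ L → comp (comp L) ≡ L
  comp-involutive (lit b A) = cong (λ b → lit b A) (not-involutive b)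

  comp-injective : ∀ {K L} → comp K ≡ comp L → K ≡ L
  comp-injective {K} {L} eq = trans (sym (comp-involutive K)) (trans (cong comp eq) (comp-involutive L))

  same-atom : ∀ {K L} → atom K ≡ atom L → K ≡ L ⊎ K ≡ comp L
  same-atom {lit false _} {lit false _} refl = inj₁ refl
  same-atom {lit false _} {lit true  _} refl = inj₂ refl
  same-atom {lit true  _} {lit false _} refl = inj₂ refl
  same-atom {lit true  _} {lit true  _} refl = inj₁ refl

  two-perm : ∀ {D : Clause} {x y} → length D ≤ 2 → x ∈ D → y ∈ D → x ≢ y → (x ∷ y ∷ []) ↭ D
  two-perm {_ ∷ _ ∷ _ ∷ _} (s≤s (s≤s ()))
  two-perm {_ ∷ []}     _ (here refl)         (here refl)         x≢y = ⊥-elim (x≢y refl)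
  two-perm {_ ∷ _ ∷ []} _ (here refl)         (here refl)         x≢y = ⊥-elim (x≢y refl)
  two-perm {_ ∷ _ ∷ []} _ (here refl)         (there (here refl)) _   = ↭-refl
  two-perm {_ ∷ _ ∷ []} _ (there (here refl)) (here refl)         _   = ↭-swap _ _ ↭-refl
  two-perm {_ ∷ _ ∷ []} _ (there (here refl)) (there (here refl)) x≢y = ⊥-elim (x≢y refl)

  Unassigned : Atom → Trail → Set
  Unassigned A = All (λ e → atom (elit e) ≢ A)

  Consistent : Trail → Set
  Consistent = AllPairs (λ e e′ → atom (elit e′) ≢ atom (elit e))

  ∈M-≼ : ∀ {K S M} → S ≼ M → K ∈M S → K ∈M M
  ∈M-≼ ≼-refl     m = m
  ∈M-≼ (≼-step p) m = there (∈M-≼ p m)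

  ∈M-position : ∀ {K M} → K ∈M M → ∃₂ λ e Q → elit e ≡ K × (e ∷ Q) ≼ M
  ∈M-position {M = e ∷ M} (here K≡e) = e , M , sym K≡e , ≼-refl
  ∈M-position {M = _ ∷ M} (there m) with ∈M-position m
  ... | e , Q , e≡K , p = e , Q , e≡K , ≼-step p

  unassigned-≼ : ∀ {A S M} → S ≼ M → Unassigned A M → Unassigned A S
  unassigned-≼ ≼-refl     u       = u
  unassigned-≼ (≼-step p) (_ ∷ u) = unassigned-≼ p u

  unassigned⇒∉M : ∀ {K M} → Unassigned (atom K) M → K ∉M M
  unassigned⇒∉M (K≢e ∷ _) (here K≡e) = K≢e (cong atom (sym K≡e))
  unassigned⇒∉M (_ ∷ u)   (there m)  = unassigned⇒∉M u m

  unassigned⇒≢ : ∀ {L K M} → Unassigned (atom L) M → K ∈M M → L ≢ K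
  unassigned⇒≢ u m refl = unassigned⇒∉M u m

  unassigned⇒comp∉M : ∀ {K M} → Unassigned (atom K) M → comp K ∉M M
  unassigned⇒comp∉M {K} {M} u = unassigned⇒∉M (subst (λ A → Unassigned A M) (sym (atom-comp K)) u)

  ∉M⇒unassigned : ∀ {K M} → K ∉M M → comp K ∉M M → Unassigned (atom K) M
  ∉M⇒unassigned {M = []}    _   _    = []
  ∉M⇒unassigned {K} {e ∷ M} K∉M cK∉M = e≢K ∷ ∉M⇒unassigned (K∉M ∘ there) (cK∉M ∘ there)
    where
    e≢K : atom (elit e) ≢ atom K
    e≢K eq with same-atom eq
    ... | inj₁ e≡K  = K∉M (here (sym e≡K))
    ... | inj₂ e≡cK = cK∉M (here (sym e≡cK))

  consistent-≼ : ∀ {S M} → S ≼ M → Consistent M → Consistent S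
  consistent-≼ ≼-refl     c       = c
  consistent-≼ (≼-step p) (_ ∷ c) = consistent-≼ p c

  suffix-≼ : ∀ {M L S} → Suffix M L S → S ≼ M
  suffix-≼ (here _)    = ≼-refl
  suffix-≼ (there _ s) = ≼-step (suffix-≼ s)

  suffix-head : ∀ {M L e Q} → Suffix M L (e ∷ Q) → elit e ≡ L
  suffix-head (here e≡L)  = e≡L
  suffix-head (there _ s) = suffix-head s

  unassigned-below-suffix : ∀ {M K S d M₀} → Consistent M → Suffix M K S → (d ∷ M₀) ≼ S → Unassigned (atom K) M₀
  unassigned-below-suffix (u ∷ _) (here refl) p = unassigned-≼ (≼-∷⁻ p) u
  unassigned-below-suffix (_ ∷ c) (there _ s) p = unassigned-below-suffix c s p

  atSuffix-≼ : ∀ {M L S} → AtSuffix M L S → S ≼ M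
  atSuffix-≼ (here _)    = ≼-refl
  atSuffix-≼ (there _ s) = ≼-step (atSuffix-≼ s)

  atSuffix-functional : ∀ {M L S S′} → AtSuffix M L S → AtSuffix M L S′ → S ≡ S′
  atSuffix-functional (here _)    (here _)     = refl
  atSuffix-functional (here a)    (there a≢ _) = ⊥-elim (a≢ a)
  atSuffix-functional (there a≢ _) (here a)    = ⊥-elim (a≢ a)
  atSuffix-functional (there _ s) (there _ s′) = atSuffix-functional s s′

  atSuffix-assigned : ∀ {M L S} → AtSuffix M L S → ¬ Unassigned (atom L) S
  atSuffix-assigned (here a)    (a≢ ∷ _) = a≢ a
  atSuffix-assigned (there _ s) u        = atSuffix-assigned s u

  atSuffix-atom : ∀ {M L L′ S} → atom L ≡ atom L′ → AtSuffix M L S → AtSuffix M L′ S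
  atSuffix-atom eq (here a)     = here (trans a eq)
  atSuffix-atom eq (there a≢ s) = there (λ a → a≢ (trans a (sym eq))) (atSuffix-atom eq s)

  atSuffix-lift : ∀ {M Q L S} → Consistent M → Q ≼ M → AtSuffix Q L S → AtSuffix M L S
  atSuffix-lift _       ≼-refl     s = s
  atSuffix-lift {e ∷ M} {L = L} (u ∷ c) (≼-step p) s = there e≢L s′
    where
    s′ = atSuffix-lift c p s
    e≢L : atom (elit e) ≢ atom L
    e≢L eq = atSuffix-assigned s′ (unassigned-≼ (atSuffix-≼ s′) (subst (λ A → Unassigned A M) eq u))

  suffix⇒atSuffix : ∀ {M L e Q} → Consistent M → Suffix M L (e ∷ Q) → AtSuffix M L (e ∷ Q)
  suffix⇒atSuffix c s = atSuffix-lift c (suffix-≼ s) (here (cong atom (suffix-head s)))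

  falsified-atSuffix : ∀ {M M₀ L} → Consistent M → M₀ ≼ M → comp L ∈M M₀ → ∃ λ S → AtSuffix M L S × S ≼ M₀
  falsified-atSuffix {L = L} c p m with ∈M-position m
  ... | e , Q , e≡cL , q = e ∷ Q , atSuffix-lift c (≼-trans q p) (here (trans (cong atom e≡cL) (atom-comp L))) , q

  count-atSuffix : ∀ {M L u S} → CountIs M L u → AtSuffix M L S → u ≡ fin (length S)
  count-atSuffix (cnt-fin s)    s′ = cong (fin ∘ length) (atSuffix-functional s s′)
  count-atSuffix (cnt-ω no-at) s′ = ⊥-elim (no-at _ s′)

  atSuffix⇒≤ : ∀ {M L L′ S S′} → AtSuffix M L S → AtSuffix M L′ S′ → length S ≤ length S′ → L ≤[ M ] L′
  atSuffix⇒≤ s s′ le _ _ cu cv = subst₂ _≤ω_ (sym (count-atSuffix cu s)) (sym (count-atSuffix cv s′)) (fin≤fin le)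

  unassigned⇒≤ : ∀ {M L L′} → Unassigned (atom L′) M → L ≤[ M ] L′
  unassigned⇒≤ u′ _ _ _ (cnt-fin s) = ⊥-elim (atSuffix-assigned s (unassigned-≼ (atSuffix-≼ s) u′))
  unassigned⇒≤ u′ u _ _ (cnt-ω _)   = u ≤ω-ω

  -- Whether L has an entry on M is undecidable here, so the proof shows that any entry for L
  -- would lie within M₀; hence Count_M(L) = ω, contradicting L ≤_M L′.
  ≤-falsified⇒assigned : ∀ {M M₀ L L′} → Consistent M → L ≤[ M ] L′ → M₀ ≼ M → comp L′ ∈M M₀ →
                         ¬ Unassigned (atom L) M₀
  ≤-falsified⇒assigned {M} {M₀} {L} c L≤L′ M₀≼M m u with falsified-atSuffix c M₀≼M m
  ... | S′ , s′ , S′≼M₀ = ω≰fin (L≤L′ ω _ (cnt-ω not-at) (cnt-fin s′))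
    where
    not-at : ∀ S → ¬ AtSuffix M L S
    not-at S s with L≤L′ _ _ (cnt-fin s) (cnt-fin s′)
    ... | fin≤fin S≤S′ = atSuffix-assigned s (unassigned-≼ S≼M₀ u)
      where
      S≼M₀ = ≼-by-length (atSuffix-≼ s) M₀≼M (≤-trans S≤S′ (≼-length S′≼M₀))

  UnitUnder : Clause → Trail → Set
  UnitUnder C M = ∃₂ λ x y → x ∈ C × y ∈ C × Unassigned (atom x) M × comp y ∈M M

  NoMissedPropagation : Clause → Trail → Set
  NoMissedPropagation C M = ∀ {L M₀} → (entry L nothing ∷ M₀) ≼ M → ¬ UnitUnder C M₀

  noMissed-[] : ∀ {C} → NoMissedPropagation C []
  noMissed-[] ()

  noMissed-≼ : ∀ {C S M} → S ≼ M → NoMissedPropagation C M → NoMissedPropagation C S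
  noMissed-≼ p nm q = nm (≼-trans q p)

  noMissed-decide : ∀ {C M L} → ¬ UnitUnder C M → NoMissedPropagation C M →
                    NoMissedPropagation C (entry L nothing ∷ M)
  noMissed-decide ¬unit _  ≼-refl     = ¬unit
  noMissed-decide _     nm (≼-step p) = nm p

  noMissed-propagate : ∀ {C M L R} → NoMissedPropagation C M → NoMissedPropagation C (entry L (just R) ∷ M)
  noMissed-propagate nm (≼-step p) = nm p

  fewerThanTwo⇒noMissed : ∀ {C M} → FewerThanTwoLiterals C → NoMissedPropagation C M
  fewerThanTwo⇒noMissed one _ (x , y , x∈ , y∈ , ux , cy∈) with one x y x∈ y∈
  ... | refl = unassigned⇒comp∉M ux cy∈

  data Justified (G : ClauseSet) : Trail → Set where
    []         : Justified G []
    decided    : ∀ {L M} → Justified G M → Justified G (entry L nothing ∷ M)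
    propagated : ∀ {L Δ M} → (L ∷ Δ) ∈G G → M ⊨¬ Δ → Justified G M →
                 Justified G (entry L (just (L ∷ Δ)) ∷ M)

  justified-≼ : ∀ {G S M} → S ≼ M → Justified G M → Justified G S
  justified-≼ ≼-refl     j                  = j
  justified-≼ (≼-step p) (decided j)        = justified-≼ p j
  justified-≼ (≼-step p) (propagated _ _ j) = justified-≼ p j

  justified-mono : ∀ {G G′ M} → (∀ {D} → G D → G′ D) → Justified G M → Justified G′ M
  justified-mono G⊆G′ []                             = []
  justified-mono G⊆G′ (decided j)                    = decided (justified-mono G⊆G′ j)
  justified-mono G⊆G′ (propagated (D , gD , D↭) f j) = propagated (D , G⊆G′ gD , D↭) f (justified-mono G⊆G′ j)

  reason-justified : ∀ {G e S L Δ} → Justified G (e ∷ S) → reason e ≡ just (L ∷ Δ) → (L ∷ Δ) ∈G G × S ⊨¬ Δ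
  reason-justified (propagated inG f _) refl = inG , f

  record Invariant (G : ClauseSet) (M : Trail) : Set where
    field
      binary     : ∀ D → G D → length D ≤ 2
      consistent : Consistent M
      justified  : Justified G M
      noMissed   : ∀ D → G D → NoMissedPropagation D M

  record ConflictInvariant (M : Trail) (C : Clause) : Set where
    constructor conflictInvariant
    field
      short     : length C ≤ 2
      falsified : M ⊨¬ C
      noMissed  : NoMissedPropagation C M

  FalsifiedAfter : Trail → Literal → Literal → Set
  FalsifiedAfter M K L = ∃₂ λ e Q → Suffix M (comp K) (e ∷ Q) × comp L ∈M Q

  falsified-trichotomy : ∀ {M K L} → Consistent M → comp K ∈M M → comp L ∈M M →
                         K ≡ L ⊎ FalsifiedAfter M K L ⊎ FalsifiedAfter M L K
  falsified-trichotomy {e ∷ M} (_ ∷ _) (here cK≡e) (here cL≡e) = inj₁ (comp-injective (trans cK≡e (sym cL≡e)))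
  falsified-trichotomy {e ∷ M} (_ ∷ _) (here cK≡e) (there m)   = inj₂ (inj₁ (e , M , here (sym cK≡e) , m))
  falsified-trichotomy {e ∷ M} (_ ∷ _) (there m)   (here cL≡e) = inj₂ (inj₂ (e , M , here (sym cL≡e) , m))
  falsified-trichotomy {e ∷ M} (u ∷ c) (there mK)  (there mL) with falsified-trichotomy c mK mL
  ... | inj₁ K≡L                     = inj₁ K≡L
  ... | inj₂ (inj₁ (e′ , Q , s , m)) = inj₂ (inj₁ (e′ , Q , there (unassigned⇒≢ u mK) s , m))
  ... | inj₂ (inj₂ (e′ , Q , s , m)) = inj₂ (inj₂ (e′ , Q , there (unassigned⇒≢ u mL) s , m))

  falsified-at-current-level : ∀ {C K L Q} → Consistent Q → NoMissedPropagation C Q → K ∈ C → L ∈ C →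
                               Unassigned (atom K) Q → comp L ∈M Q →
                               ∃ λ S → AtSuffix Q L S × decisions S ≡ decisions Q
  falsified-at-current-level {L = L} {e ∷ Q} _ _ _ _ _ (here cL≡e) =
    e ∷ Q , here (trans (cong atom (sym cL≡e)) (atom-comp L)) , refl
  falsified-at-current-level {K = K} {L} {entry _ nothing ∷ Q} _ nm K∈ L∈ (_ ∷ uK) (there m) =
    ⊥-elim (nm ≼-refl (K , L , K∈ , L∈ , uK , m))
  falsified-at-current-level {L = L} {entry L₀ (just _) ∷ Q} (u ∷ c) nm K∈ L∈ (_ ∷ uK) (there m)
    with falsified-at-current-level c (noMissed-≼ (≼-step ≼-refl) nm) K∈ L∈ uK m
  ... | S , s , same-level = S , there e≢L s , same-level
    where
    e≢L : atom L₀ ≢ atom L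
    e≢L eq = unassigned⇒comp∉M (subst (λ A → Unassigned A Q) eq u) m

  backjump-same-level : ∀ {G M C K L L₀ Δ Q S} → Consistent M → length C ≤ 2 → K ∈ C → L ∈ C → K ≢ L →
                        Suffix M (comp K) (entry L₀ (just (L₀ ∷ Δ)) ∷ Q) →
                        AtSuffix M L S → S ≼ Q → decisions S ≡ decisions Q →
                        Backjump ⟨ G , M , just C ⟩ ⟨ G , M , just (Δ ++ L ∷ []) ⟩
  backjump-same-level {M = M} {K = K} {Δ = Δ} c len K∈ L∈ K≢L suf atL S≼Q same-level =
    backjump (two-perm len K∈ L∈ K≢L , L≤K ∷ [-]) (here refl) (_ , lvl-fin atL , levelK) suf reason≡
    where
    atcK = suffix⇒atSuffix c suf
    L≤K = atSuffix⇒≤ atL (atSuffix-atom (atom-comp K) atcK) (m≤n⇒m≤1+n (≼-length S≼Q))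
    levelK = subst (LevelIs M (comp K)) (cong fin (sym same-level)) (lvl-fin atcK)
    reason≡ = cong (λ L₀ → just (L₀ ∷ Δ)) (suffix-head suf)

  backjump-applies : ∀ {G M C K L} → Consistent M → Justified G M → length C ≤ 2 → NoMissedPropagation C M →
                     K ∈ C → L ∈ C → FalsifiedAfter M K L → Σ State (Backjump ⟨ G , M , just C ⟩)
  backjump-applies {G} {M} {C} {K} {L} c j len nm K∈ L∈ (_ , Q , suf , cL∈Q) =
    by-reason (justified-≼ (suffix-≼ suf) j) suf
    where
    Q≼M = ≼-tail (suffix-≼ suf)
    uK : Unassigned (atom K) Q
    uK = subst (λ A → Unassigned A Q) (atom-comp K) (unassigned-below-suffix c suf ≼-refl)
    K≢L : K ≢ L
    K≢L refl = unassigned⇒comp∉M uK cL∈Q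
    by-reason : ∀ {e} → Justified G (e ∷ Q) → Suffix M (comp K) (e ∷ Q) → Σ State (Backjump ⟨ G , M , just C ⟩)
    by-reason (decided _) s = ⊥-elim (nm (suffix-≼ s) (K , L , K∈ , L∈ , uK , cL∈Q))
    by-reason (propagated _ _ _) s
      with falsified-at-current-level (consistent-≼ Q≼M c) (noMissed-≼ Q≼M nm) K∈ L∈ uK cL∈Q
    ... | S , atL , same-level =
      _ , backjump-same-level c len K∈ L∈ K≢L s (atSuffix-lift c Q≼M atL) (atSuffix-≼ atL) same-level

  noBackjump⇒fewerThanTwo : ∀ {G M C} → Consistent M → Justified G M → ConflictInvariant M C →
                            ¬ (Σ State λ s → Backjump ⟨ G , M , just C ⟩ s) → FewerThanTwoLiterals C
  noBackjump⇒fewerThanTwo c j (conflictInvariant len f nm) no-bj a b a∈ b∈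
    with falsified-trichotomy c (f a a∈) (f b b∈)
  ... | inj₁ a≡b       = a≡b
  ... | inj₂ (inj₁ ab) = ⊥-elim (no-bj (backjump-applies c j len nm a∈ b∈ ab))
  ... | inj₂ (inj₂ ba) = ⊥-elim (no-bj (backjump-applies c j len nm b∈ a∈ ba))

  unit⇒propagatable : ∀ {G M D} → G D → length D ≤ 2 → UnitUnder D M → ∃₂ λ L Γ → InSort G M L Γ × M ⊨¬ Γ
  unit⇒propagatable gD len (x , y , x∈ , y∈ , ux , cy∈) =
    x , y ∷ [] , (_ , gD , two-perm len x∈ y∈ x≢y , unassigned⇒≤ ux ∷ [-]) , λ { _ (here refl) → cy∈ }
    where
    x≢y : x ≢ y
    x≢y refl = unassigned⇒comp∉M ux cy∈

  resolvent-noMissed : ∀ {M C D K L δ e S} → Consistent M → NoMissedPropagation C M → NoMissedPropagation D M →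
                       K ∈ C → L ∈ C → L ≤[ M ] K → comp K ∈ D → δ ∈ D →
                       Suffix M (comp K) (e ∷ S) → comp δ ∈M S → NoMissedPropagation (δ ∷ L ∷ []) M
  resolvent-noMissed {K = K} {L} {δ} {e} {S} c nmC nmD K∈ L∈ L≤K cK∈ δ∈ suf cδ∈S {M₀ = M₀} p
                     (x , y , x∈ , y∈ , ux , cy∈) =
    by-position (≼-connex (≼-tail p) (suffix-≼ suf)) x∈ y∈ ux cy∈
    where
    ucK : M₀ ≼ S → Unassigned (atom (comp K)) M₀
    ucK M₀≼S = unassigned-≼ M₀≼S (unassigned-below-suffix c suf ≼-refl)
    cK∈M₀ : (e ∷ S) ≼ M₀ → comp K ∈M M₀
    cK∈M₀ eS≼M₀ = ∈M-≼ eS≼M₀ (here (sym (suffix-head suf)))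
    by-position : ∀ {x y} → M₀ ≼ S ⊎ (e ∷ S) ≼ M₀ → x ∈ δ ∷ L ∷ [] → y ∈ δ ∷ L ∷ [] →
                  Unassigned (atom x) M₀ → comp y ∈M M₀ → ⊥
    by-position (inj₁ M₀≼S) _ (here refl) _ cy∈ =
      nmD p (comp K , δ , cK∈ , δ∈ , ucK M₀≼S , cy∈)
    by-position (inj₁ M₀≼S) _ (there (here refl)) _ cy∈ =
      nmC p (K , L , K∈ , L∈ , subst (λ A → Unassigned A M₀) (atom-comp K) (ucK M₀≼S) , cy∈)
    by-position (inj₂ eS≼M₀) (here refl) _ ux _ =
      unassigned⇒comp∉M ux (∈M-≼ (≼-tail eS≼M₀) cδ∈S)
    by-position (inj₂ eS≼M₀) (there (here refl)) _ ux _ =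
      ≤-falsified⇒assigned c L≤K (≼-tail p) (cK∈M₀ eS≼M₀) ux

  sorted-noMissed : ∀ {M C L′ L S} → Consistent M → IsSortOf M C (L′ ∷ L ∷ []) → S ≼ M →
                    (∀ {d M₀} → (d ∷ M₀) ≼ S → comp L ∉M M₀) → NoMissedPropagation C S
  sorted-noMissed {L′ = L′} {L} c (C↭ , L≤L′ ∷ [-]) S≼M cL∉ {M₀ = M₀} p (x , y , x∈ , y∈ , ux , cy∈) =
    by-literal (∈-resp-↭ (↭-sym C↭) x∈) (∈-resp-↭ (↭-sym C↭) y∈) ux cy∈
    where
    by-literal : ∀ {x y} → x ∈ L′ ∷ L ∷ [] → y ∈ L′ ∷ L ∷ [] → Unassigned (atom x) M₀ → comp y ∈M M₀ → ⊥
    by-literal _                   (there (here refl)) _  cy∈ = cL∉ p cy∈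
    by-literal (here refl)         (here refl)         ux cy∈ = unassigned⇒comp∉M ux cy∈
    by-literal (there (here refl)) (here refl)         ux cy∈ =
      ≤-falsified⇒assigned c L≤L′ (≼-trans (≼-tail p) S≼M) cy∈ ux

  ↭-too-long : ∀ {x y z : Literal} {zs C} → (x ∷ y ∷ z ∷ zs) ↭ C → ¬ length C ≤ 2
  ↭-too-long C↭ len with subst (_≤ 2) (sym (↭-length C↭)) len
  ... | s≤s (s≤s ())

  instTrail-noMissed : ∀ {M C M′} → Consistent M → length C ≤ 2 → InstTrail M C M′ → NoMissedPropagation C M′
  instTrail-noMissed _ _   (unit _)                        = noMissed-[]
  instTrail-noMissed _ len (back {Γ = _ ∷ _} (C↭ , _) _ _) = ⊥-elim (↭-too-long C↭ len)
  instTrail-noMissed _ len (stay {Γ = _ ∷ _} (C↭ , _) _)   = ⊥-elim (↭-too-long C↭ len)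
  instTrail-noMissed c _   (back {Γ = []} sorted _ suf) =
    sorted-noMissed c sorted (suffix-≼ suf) (λ p → unassigned⇒∉M (unassigned-below-suffix c suf p))
  instTrail-noMissed c _   (stay {Γ = []} sorted M⊭¬L) =
    sorted-noMissed c sorted ≼-refl (λ p cL∈ → M⊭¬L λ { _ (here refl) → ∈M-≼ (≼-tail p) cL∈ })

  singleton-fewerThanTwo : ∀ {L} → FewerThanTwoLiterals (L ∷ [])
  singleton-fewerThanTwo _ _ (here refl) (here refl) = refl

  backjump-preserves : ∀ {G M C K Γ L e S Δ} → Invariant G M → ConflictInvariant M C →
                       IsSortOf M C (K ∷ Γ) → L ∈ Γ → Suffix M (comp K) (e ∷ S) → reason e ≡ just (comp K ∷ Δ) →
                       ConflictInvariant M (Δ ++ Γ)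
  backjump-preserves {Γ = _ ∷ _ ∷ _} _ ci (C↭ , _) _ _ _ = ⊥-elim (↭-too-long C↭ (ConflictInvariant.short ci))
  backjump-preserves {M = M} {K = K} {Γ = L ∷ []} {S = S} {Δ = Δ}
                     inv (conflictInvariant _ f nmC) (C↭ , L≤K ∷ [-]) (here refl) suf reason≡
    with reason-justified (justified-≼ (suffix-≼ suf) (Invariant.justified inv)) reason≡
  ... | (D , gD , D↭) , S⊨¬Δ = resolve Δ D↭ S⊨¬Δ
    where
    open Invariant inv
    resolve : ∀ Δ → D ↭ (comp K ∷ Δ) → S ⊨¬ Δ → ConflictInvariant M (Δ ++ L ∷ [])
    resolve [] _ _ =
      conflictInvariant (s≤s z≤n) (λ { _ (here refl) → f L (∈-resp-↭ C↭ (there (here refl))) })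
                        (fewerThanTwo⇒noMissed singleton-fewerThanTwo)
    resolve (δ ∷ []) D↭ S⊨¬δ = conflictInvariant (s≤s (s≤s z≤n)) falsified′ resolvent
      where
      falsified′ : M ⊨¬ (δ ∷ L ∷ [])
      falsified′ _ (here refl)         = ∈M-≼ (≼-tail (suffix-≼ suf)) (S⊨¬δ δ (here refl))
      falsified′ _ (there (here refl)) = f L (∈-resp-↭ C↭ (there (here refl)))
      resolvent = resolvent-noMissed consistent nmC (noMissed D gD)
                    (∈-resp-↭ C↭ (here refl)) (∈-resp-↭ C↭ (there (here refl))) L≤K
                    (∈-resp-↭ (↭-sym D↭) (here refl)) (∈-resp-↭ (↭-sym D↭) (there (here refl)))
                    suf (S⊨¬δ δ (here refl))
    resolve (_ ∷ _ ∷ _) D↭ _ = ⊥-elim (↭-too-long (↭-sym D↭) (binary D gD))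

  invariant-∪ : ∀ {G M S C} → Invariant G M → S ≼ M → length C ≤ 2 → NoMissedPropagation C S →
                Invariant (G ∪[ C ]) S
  invariant-∪ inv S≼M len nmC = record
    { binary     = λ { D (inj₁ gD) → binary D gD ; _ (inj₂ refl) → len }
    ; consistent = consistent-≼ S≼M consistent
    ; justified  = justified-mono inj₁ (justified-≼ S≼M justified)
    ; noMissed   = λ { D (inj₁ gD) → noMissed-≼ S≼M (noMissed D gD) ; _ (inj₂ refl) → nmC }
    }
    where open Invariant inv

  learnTrail-≼ : ∀ {M C M′} → LearnTrail M C M′ → M′ ≼ M
  learnTrail-≼ (unit _)        = []≼
  learnTrail-≼ (nonunit _ suf) = suffix-≼ suf

  instTrail-≼ : ∀ {M C M′} → InstTrail M C M′ → M′ ≼ M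
  instTrail-≼ (unit _)       = []≼
  instTrail-≼ (back _ _ suf) = suffix-≼ suf
  instTrail-≼ (stay _ _)     = ≼-refl

  StateInvariant : State → Set
  StateInvariant ⟨ G , M , nothing ⟩ = Invariant G M
  StateInvariant ⟨ G , M , just C ⟩  = Invariant G M × ConflictInvariant M C
  StateInvariant (SAT _)             = ⊤
  StateInvariant UNSAT               = ⊤

  module Derivations (S : ClauseSet) (T : TriggerFunction S) (binary-S : ∀ C → S C → length C ≤ 2) where

    step-preserves : ∀ {s s′} → Step S T s s′ → StateInvariant s → StateInvariant s′
    step-preserves (decide no-prop _ A∉M ¬A∉M) inv = record
      { binary     = binary
      ; consistent = ∉M⇒unassigned ¬A∉M A∉M ∷ consistent
      ; justified  = decided justified
      ; noMissed   = λ D gD → noMissed-decide (no-prop ∘ unit⇒propagatable gD (binary D gD)) (noMissed D gD)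
      }
      where open Invariant inv
    step-preserves (propagate (D , gD , sorted) M⊨¬Γ L∉M cL∉M) inv = record
      { binary     = binary
      ; consistent = ∉M⇒unassigned L∉M cL∉M ∷ consistent
      ; justified  = propagated (D , gD , ↭-sym (proj₁ sorted)) M⊨¬Γ justified
      ; noMissed   = λ D gD → noMissed-propagate (noMissed D gD)
      }
      where open Invariant inv
    step-preserves (conflict gC M⊨¬C) inv =
      inv , conflictInvariant (Invariant.binary inv _ gC) M⊨¬C (Invariant.noMissed inv _ gC)
    step-preserves (backjumpₛ (backjump sorted L∈Γ _ suf reason≡)) (inv , ci) =
      inv , backjump-preserves inv ci sorted L∈Γ suf reason≡
    step-preserves (learnₛ (learn no-bj _ lt)) (inv , ci) =
      invariant-∪ inv (learnTrail-≼ lt) (ConflictInvariant.short ci) (fewerThanTwo⇒noMissed learned-short)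
      where
      learned-short = noBackjump⇒fewerThanTwo (Invariant.consistent inv) (Invariant.justified inv) ci no-bj
    step-preserves (instₛ (instantiate (D , (sD , _) , θ , _ , refl) _ it)) inv =
      invariant-∪ inv (instTrail-≼ it) len (instTrail-noMissed (Invariant.consistent inv) len it)
      where
      len = subst (_≤ 2) (sym (length-map (substL θ) D)) (binary-S D sD)
    step-preserves (succeed _ _ _) _ = tt
    step-preserves fail            _ = tt

    initial-invariant : StateInvariant (initial S)
    initial-invariant = record
      { binary = λ D gD → binary-S D (proj₁ gD) ; consistent = [] ; justified = [] ; noMissed = λ _ _ → noMissed-[] }

    reachable-invariant : ∀ {s} → Star (Step S T) (initial S) s → StateInvariant s
    reachable-invariant = go initial-invariant
      where
      go : ∀ {s s′} → StateInvariant s → Star (Step S T) s s′ → StateInvariant s′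
      go inv ε          = inv
      go inv (st ◅ run) = go (step-preserves st inv) run

mainTheorem11 : (sig : Signature) → let open FOL sig in
    (S : ClauseSet) → (∀ C → S C → length C ≤ 2) →
    (T : TriggerFunction S) →
    ∀ {G M C s} →
    Star (Step S T) (initial S) ⟨ G , M , just C ⟩ →
    Learn ⟨ G , M , just C ⟩ s →
    FewerThanTwoLiterals C
mainTheorem11 sig S binary-S T run (FOL.learn no-bj _ _) =
  let inv , conflict-inv = reachable-invariant run
      open Invariant inv
  in  noBackjump⇒fewerThanTwo consistent justified conflict-inv no-bj
  where
  open BinaryCDCL sig
  open Derivations S T binary-S
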